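{- Let $(X,A_\tau,\rightarrow)$ be a labelled transition system. (1) For all states $p,t,q,q'$: if $p\twoheadrightarrow_\tau t$, $q\rightarrow_\tau q'$, $q'\mathrel{\#_{sb}} p$, and for all $p',p''$ with $p\twoheadrightarrow_\tau p'\rightarrow_\tau p''$ we have $q'\mathrel{\#_{sb}}p''\vee(q\mathrel{\#_{sb}}p'\wedge q\mathrel{\#_{sb}}p'')$, then $q\mathrel{\#_{sb}} t$. (2) For all states $p,t,q,q'$ and $a\in A$: if $p\twoheadrightarrow_\tau t$, $q\rightarrow_a q'$, and for all $p',p''$ with $p\twoheadrightarrow_\tau p'\rightarrow_a p''$ we have $q\mathrel{\#_{sb}}p'\vee q'\mathrel{\#_{sb}}p''$, then $q\mathrel{\#_{sb}} t$.
   Context: An LTS is a triple $(X,A_\tau,\rightarrow)$ with $X$ a set of states, $A_\tau=A\cup\{\tau\}$ where $\tau\notin A$ is the silent action, and $\rightarrow\subseteq X\times A_\tau\times X$; write $q\rightarrow_u q'$ for $(q,u,q')\in\rightarrow$. $\twoheadrightarrow_\tau$ is the reflexive-transitive closure of $\rightarrow_\tau$. A relation $Q\subseteq X\times X$ is a semi-branching apartness if: (symm) $Q(p,q)\Rightarrow Q(q,p)$; (in$_{sb\tau}$) if $q\rightarrow_\tau q'$, $Q(q',p)$, and for all $p',p''$ with $p\twoheadrightarrow_\tau p'\rightarrow_\tau p''$ we have $Q(q',p'')\vee(Q(q,p')\wedge Q(q,p''))$, then $Q(q,p)$; (in$_b$) for each $a\in A$: if $q\rightarrow_a q'$ and for all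 $p',p''$ with $p\twoheadrightarrow_\tau p'\rightarrow_a p''$ we have $Q(q,p')\vee Q(q',p'')$, then $Q(q,p)$. $q\mathrel{\#_{sb}}p$ means $Q(q,p)$ for every semi-branching apartness $Q$. -}

module Defs where

open import Level using (Level; _⊔_; suc)
open import Data.Product using (_×_)
open import Data.Sum using (_⊎_)
open import Relation.Binary.Construct.Closure.ReflexiveTransitive using (Star)

data Act (A : Set) : Set where
  τ   : Act A
  act : A → Act A

record LTS : Set₁ where
  field
    X    : Set
    A    : Set
    _⟶[_]_ : X → Act A → X → Set

module _ (L : LTS) where
  open LTS L

  _⟶τ_ : X → X → Set
  q ⟶τ q' = q ⟶[ τ ] q'

  _↠τ_ : X → X → Set
  _↠τ_ = Star _⟶τ_

  record IsSemiBranchingApartness (Q : X → X → Set) : Set where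
    field
      symm : ∀ {p q} → Q p q → Q q p
      in-sbτ : ∀ {q q' p} → q ⟶τ q' → Q q' p →
               (∀ p' p'' → p ↠τ p' → p' ⟶τ p'' →
                  Q q' p'' ⊎ (Q q p' × Q q p'')) →
               Q q p
      in-b : ∀ (a : A) {q q' p} → q ⟶[ act a ] q' →
             (∀ p' p'' → p ↠τ p' → p' ⟶[ act a ] p'' →
                Q q p' ⊎ Q q' p'') →
             Q q p

  _#sb_ : X → X → Set₁
  q #sb p = ∀ (Q : X → X → Set) → IsSemiBranchingApartness Q → Q q p

-- Fix one semi-branching apartness Q.  Both rules may be applied at any τ-descendant t of p,
-- since every τ-path from t extends one from p.  The τ-rule additionally needs Q q' t: along
-- p ↠τ t the invariant "Q q' u or Q q u" holds (each τ-step p' ⟶τ p'' yields Q q' p'' or Q q p''),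
-- and at u = t either disjunct gives Q q t.
module Submission where

open import Defs
open import Data.Product using (_×_; _,_; proj₂)
open import Data.Sum using (_⊎_; inj₁; inj₂)
import Data.Product as Product
import Data.Sum as Sum
open import Relation.Binary.Construct.Closure.ReflexiveTransitive using (ε; _◅_; _◅◅_; return)

module _ (L : LTS) where
  open LTS L

  SbτPremise : ∀ {ℓ} → (X → X → Set ℓ) → X → X → X → Set ℓ
  SbτPremise Q q q' p = ∀ p' p'' → _↠τ_ L p p' → _⟶τ_ L p' p'' → Q q' p'' ⊎ (Q q p' × Q q p'')

  BPremise : ∀ {ℓ} → (X → X → Set ℓ) → A → X → X → X → Set ℓ
  BPremise Q a q q' p = ∀ p' p'' → _↠τ_ L p p' → p' ⟶[ act a ] p'' → Q q p' ⊎ Q q' p''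

  SbτPremise-↠τ : ∀ {ℓ} {Q : X → X → Set ℓ} {q q' p t} → _↠τ_ L p t → SbτPremise Q q q' p → SbτPremise Q q q' t
  SbτPremise-↠τ pt h p' p'' tp' = h p' p'' (pt ◅◅ tp')

  BPremise-↠τ : ∀ {ℓ} {Q : X → X → Set ℓ} {a q q' p t} → _↠τ_ L p t → BPremise Q a q q' p → BPremise Q a q q' t
  BPremise-↠τ pt h p' p'' tp' = h p' p'' (pt ◅◅ tp')

  module _ {Q : X → X → Set} (isQ : IsSemiBranchingApartness L Q) where
    open IsSemiBranchingApartness isQ

    SbτPremise-apart-along : ∀ {q q' p u t} → SbτPremise Q q q' p →
                             _↠τ_ L p u → Q q' u ⊎ Q q u → _↠τ_ L u t → Q q' t ⊎ Q q t
    SbτPremise-apart-along h pu apart ε = apart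
    SbτPremise-apart-along h pu apart (uv ◅ vt) =
      SbτPremise-apart-along h (pu ◅◅ return uv) (Sum.map₂ proj₂ (h _ _ pu uv)) vt

    in-sbτ-↠τ : ∀ {q q' p t} → _↠τ_ L p t → _⟶τ_ L q q' → Q q' p → SbτPremise Q q q' p → Q q t
    in-sbτ-↠τ pt qq' q'p h with SbτPremise-apart-along h ε (inj₁ q'p) pt
    ... | inj₁ q't = in-sbτ qq' q't (SbτPremise-↠τ {Q = Q} pt h)
    ... | inj₂ qt  = qt

    in-b-↠τ : ∀ (a : A) {q q' p t} → _↠τ_ L p t → q ⟶[ act a ] q' → BPremise Q a q q' p → Q q t
    in-b-↠τ a pt qq' h = in-b a qq' (BPremise-↠τ {Q = Q} pt h)

  SbτPremise-#sb : ∀ {Q q q' p} → IsSemiBranchingApartness L Q →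
                   SbτPremise (_#sb_ L) q q' p → SbτPremise Q q q' p
  SbτPremise-#sb {Q} isQ h p' p'' pp' p'p'' =
    Sum.map (λ apart → apart Q isQ) (Product.map (λ apart → apart Q isQ) (λ apart → apart Q isQ))
            (h p' p'' pp' p'p'')

  BPremise-#sb : ∀ {Q a q q' p} → IsSemiBranchingApartness L Q →
                 BPremise (_#sb_ L) a q q' p → BPremise Q a q q' p
  BPremise-#sb {Q} isQ h p' p'' pp' p'p'' =
    Sum.map (λ apart → apart Q isQ) (λ apart → apart Q isQ) (h p' p'' pp' p'p'')

lemma3p17 : (L : LTS) →
    let open LTS L in
    (∀ (p t q q' : X) → _↠τ_ L p t → _⟶τ_ L q q' → _#sb_ L q' p →
       (∀ (p' p'' : X) → _↠τ_ L p p' → _⟶τ_ L p' p'' →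
          _#sb_ L q' p'' ⊎ (_#sb_ L q p' × _#sb_ L q p'')) →
       _#sb_ L q t)
    × (∀ (p t q q' : X) (a : A) → _↠τ_ L p t → q ⟶[ act a ] q' →
       (∀ (p' p'' : X) → _↠τ_ L p p' → p' ⟶[ act a ] p'' →
          _#sb_ L q p' ⊎ _#sb_ L q' p'') →
       _#sb_ L q t)
lemma3p17 L =
    (λ p t q q' pt qq' q'p h Q isQ → in-sbτ-↠τ L isQ pt qq' (q'p Q isQ) (SbτPremise-#sb L isQ h))
  , (λ p t q q' a pt qq' h Q isQ → in-b-↠τ L isQ a pt qq' (BPremise-#sb L isQ h))
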